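{- Let $T$ be a tree with $n\ge2$ vertices. Then $\gamma_t(M(T))\ge |\operatorname{leaf}(T)|$, where $\operatorname{leaf}(T)=\{v\in V(T) : d_T(v)=1\}$.
   Context: All graphs are finite and simple. $d_T(v)$ denotes the degree of $v$ in $T$. For a graph $H$ with no isolated vertices, a total dominating set of $H$ is a set $S\subseteq V(H)$ such that every vertex of $H$ has at least one neighbor in $S$; $\gamma_t(H)$ is the minimum cardinality of a total dominating set. The middle graph $M(G)$ of a graph $G$ has vertex set $V(G)\cup E(G)$ (disjoint union), and two of its vertices $x,y$ are adjacent exactly when either $x,y\in E(G)$ are edges of $G$ sharing a common endpoint, or $x\in V(G)$, $y\in E(G)$ and $x$ is an endpoint of $y$ (no two elements of $V(G)$ are adjacent in $M(G)$). -}

module Defs where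

open import Data.Nat using (ℕ; zero; suc; _<_; _≤_)
open import Data.Fin using (Fin; toℕ)
open import Data.Fin.Subset using (Subset; _∈_; ∣_∣)
open import Data.Product using (Σ; _×_; _,_; ∃; ∃-syntax)
open import Data.Sum using (_⊎_; inj₁; inj₂)
open import Data.List using (List; []; _∷_; length)
open import Data.List.Relation.Unary.All using (All)
open import Data.List.Relation.Unary.Unique.Propositional using (Unique)
open import Data.Vec using (Vec; tabulate)
open import Data.Bool using (Bool; true; false)
open import Relation.Nullary using (¬_; Dec; does)
open import Relation.Binary.PropositionalEquality using (_≡_; _≢_)
open import Level using (0ℓ)
import Data.Empty
import Data.List.Relation.Unary.Any
import Data.Nat

record Graph (n : ℕ) : Set₁ where
  field
    adj       : Fin n → Fin n → Bool
    sym       : ∀ u v → adj u v ≡ adj v u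
    irrefl    : ∀ u → adj u u ≡ false

  Adj : Fin n → Fin n → Set
  Adj u v = adj u v ≡ true

module _ {n : ℕ} (G : Graph n) where
  open Graph G

  nbhd : Fin n → Subset n
  nbhd v = tabulate (λ u → adj v u)

  degree : Fin n → ℕ
  degree v = ∣ nbhd v ∣

  leafSet : Subset n
  leafSet = tabulate (λ v → does (degree v Data.Nat.≟ 1))

  numLeaves : ℕ
  numLeaves = ∣ leafSet ∣

  data Walk : Fin n → Fin n → Set where
    here  : ∀ {u} → Walk u u
    step  : ∀ {u w v} → Adj u w → Walk w v → Walk u v

  Connected : Set
  Connected = ∀ u v → Walk u v

  walkVerts : ∀ {u v} → Walk u v → List (Fin n)
  walkVerts {u} here = u ∷ []
  walkVerts {u} (step _ w) = u ∷ walkVerts w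

  walkLen : ∀ {u v} → Walk u v → ℕ
  walkLen here = 0
  walkLen (step _ w) = suc (walkLen w)

  -- a cycle: a closed walk u → … → x → u of length ≥ 3 whose vertices
  -- u, …, x are pairwise distinct
  HasCycle : Set
  HasCycle = Σ (Fin n) λ u → Σ (Fin n) λ x → Σ (Walk u x) λ p →
               Adj x u × 2 ≤ walkLen p × Unique (walkVerts p)

  Acyclic : Set
  Acyclic = ¬ HasCycle

  IsTree : Set
  IsTree = Connected × Acyclic

  -- edges of G: ordered representatives (u , v) with u < v adjacent
  Edge : Set
  Edge = Σ (Fin n) λ u → Σ (Fin n) λ v → (toℕ u < toℕ v) × Adj u v

  endpoint : Fin n → Edge → Set
  endpoint x (u , v , _) = (x ≡ u) ⊎ (x ≡ v)

  MVertex : Set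
  MVertex = Fin n ⊎ Edge

  MAdj : MVertex → MVertex → Set
  MAdj (inj₁ x) (inj₁ y) = Data.Empty.⊥
  MAdj (inj₁ x) (inj₂ e) = endpoint x e
  MAdj (inj₂ e) (inj₁ x) = endpoint x e
  MAdj (inj₂ e) (inj₂ f) = e ≢ f × ∃[ x ] (endpoint x e × endpoint x f)

  IsTDSMiddle : List MVertex → Set
  IsTDSMiddle S = ∀ (z : MVertex) → Data.List.Relation.Unary.Any.Any (MAdj z) S

  γt-Middle-≥ : ℕ → Set
  γt-Middle-≥ k = ∀ (S : List MVertex) → Unique S → IsTDSMiddle S → k ≤ length S

-- A leaf v with neighbour u is dominated in M(G) only by its edge e = vu, so e ∈ S. Charge v to e;
-- two leaves can compete for e only if e is an isolated edge {u, v} with both ends leaves. Such an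
-- edge has no neighbouring edges in M(G), so S must also contain one of its endpoints to dominate e.
-- Charging the smaller end of an isolated edge to e and the larger end to that endpoint makes the
-- charging injective, whence |leaf(G)| ≤ |S|.
module Submission where

open import Defs
open import Data.Nat using (ℕ; zero; suc; _≤_; _<_; z≤n; s≤s; _≟_; _<?_)
open import Data.Nat.Properties
  using (≤-trans; ≤-reflexive; ≤-antisym; <-asym; <⇒≱; ≮⇒≥; <-irrelevant)
open import Data.Fin as Fin using (Fin; toℕ; punchOut)
open import Data.Fin.Properties using (¬Fin0; suc-injective; punchOut-injective; toℕ-injective)
open import Data.Fin.Subset using (Subset; _∈_; ∣_∣; inside; outside)
open import Data.Fin.Subset.Properties using (∣p∣≤∣x∷p∣)
open import Data.Vec using (_∷_; []; tabulate; here; there)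
open import Data.Vec.Properties using (lookup∘tabulate; []=⇒lookup; lookup⇒[]=)
open import Data.Bool using (Bool; true)
import Data.Bool as Bool
open import Data.Product using (Σ; _×_; _,_; proj₁; proj₂)
open import Data.Sum using (_⊎_; inj₁; inj₂; swap)
open import Data.List using (List; length)
open import Data.List.Relation.Unary.Any using (index)
open import Data.List.Membership.Propositional using (find) renaming (_∈_ to _∈ₗ_)
open import Data.List.Membership.Setoid.Properties using (index-injective)
open import Function using (_∘_)
open import Relation.Nullary using (¬_; Dec; yes; no; does; contradiction; _×-dec_)
open import Relation.Binary.PropositionalEquality
  using (_≡_; _≢_; refl; sym; trans; cong; cong₂; subst; setoid)
open import Axiom.UniquenessOfIdentityProofs using (module Decidable⇒UIP)

x∈p⇒0<∣p∣ : ∀ {n} {p : Subset n} {x} → x ∈ p → 0 < ∣ p ∣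
x∈p⇒0<∣p∣ here                     = s≤s z≤n
x∈p⇒0<∣p∣ {p = s ∷ p} (there x∈p) = ≤-trans (x∈p⇒0<∣p∣ x∈p) (∣p∣≤∣x∷p∣ s p)

∣p∣≤1⇒∈-unique : ∀ {n} {p : Subset n} {x y} → ∣ p ∣ ≤ 1 → x ∈ p → y ∈ p → x ≡ y
∣p∣≤1⇒∈-unique _            here        here        = refl
∣p∣≤1⇒∈-unique (s≤s ∣p∣≤0) here        (there y∈p) = contradiction ∣p∣≤0 (<⇒≱ (x∈p⇒0<∣p∣ y∈p))
∣p∣≤1⇒∈-unique (s≤s ∣p∣≤0) (there x∈p) here        = contradiction ∣p∣≤0 (<⇒≱ (x∈p⇒0<∣p∣ x∈p))
∣p∣≤1⇒∈-unique {p = s ∷ p} ∣p∣≤1 (there x∈p) (there y∈p) =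
  cong Fin.suc (∣p∣≤1⇒∈-unique (≤-trans (∣p∣≤∣x∷p∣ s p) ∣p∣≤1) x∈p y∈p)

injection⇒∣p∣≤m : ∀ {n m} {p : Subset n} (f : ∀ {x} → x ∈ p → Fin m) →
                  (∀ {x y} (x∈p : x ∈ p) (y∈p : y ∈ p) → f x∈p ≡ f y∈p → x ≡ y) →
                  ∣ p ∣ ≤ m
injection⇒∣p∣≤m {p = []} f inj = z≤n
injection⇒∣p∣≤m {p = outside ∷ p} f inj =
  injection⇒∣p∣≤m (f ∘ there) (λ x∈p y∈p → suc-injective ∘ inj (there x∈p) (there y∈p))
injection⇒∣p∣≤m {m = zero} {p = inside ∷ p} f inj = contradiction (f here) ¬Fin0
injection⇒∣p∣≤m {m = suc m} {p = inside ∷ p} f inj = s≤s (injection⇒∣p∣≤m g g-injective)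
  where
  f-here≢ : ∀ {x} (x∈p : x ∈ p) → f here ≢ f (there x∈p)
  f-here≢ x∈p eq with inj here (there x∈p) eq
  ... | ()
  g : ∀ {x} → x ∈ p → Fin m
  g x∈p = punchOut (f-here≢ x∈p)
  g-injective : ∀ {x y} (x∈p : x ∈ p) (y∈p : y ∈ p) → g x∈p ≡ g y∈p → x ≡ y
  g-injective x∈p y∈p =
    suc-injective ∘ inj (there x∈p) (there y∈p) ∘ punchOut-injective (f-here≢ x∈p) (f-here≢ y∈p)

∈-tabulate⁻ : ∀ {n} {f : Fin n → Bool} {x} → x ∈ tabulate f → f x ≡ true
∈-tabulate⁻ {f = f} {x} x∈ = trans (sym (lookup∘tabulate f x)) ([]=⇒lookup x∈)

∈-tabulate⁺ : ∀ {n} {f : Fin n → Bool} {x} → f x ≡ true → x ∈ tabulate f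
∈-tabulate⁺ {f = f} {x} fx = lookup⇒[]= x (tabulate f) (trans (lookup∘tabulate f x) fx)

does≡true⇒ : ∀ {A : Set} (a? : Dec A) → does a? ≡ true → A
does≡true⇒ (yes a) _ = a
does≡true⇒ (no _) ()

distinct-pair-cases : ∀ {A : Set} {a b x y : A} → x ≢ y → x ≡ a ⊎ x ≡ b → y ≡ a ⊎ y ≡ b →
                      (x ≡ a × y ≡ b) ⊎ (x ≡ b × y ≡ a)
distinct-pair-cases x≢y (inj₁ x≡a) (inj₁ y≡a) = contradiction (trans x≡a (sym y≡a)) x≢y
distinct-pair-cases x≢y (inj₁ x≡a) (inj₂ y≡b) = inj₁ (x≡a , y≡b)
distinct-pair-cases x≢y (inj₂ x≡b) (inj₁ y≡a) = inj₂ (x≡b , y≡a)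
distinct-pair-cases x≢y (inj₂ x≡b) (inj₂ y≡b) = contradiction (trans x≡b (sym y≡b)) x≢y

module _ {n : ℕ} (G : Graph n) where
  open Graph G using (Adj)

  private variable
    u v w x y z : Fin n
    e f : Edge G
    c : MVertex G

  Leaf : Fin n → Set
  Leaf v = degree G v ≡ 1

  ∈-leafSet⇒Leaf : v ∈ leafSet G → Leaf v
  ∈-leafSet⇒Leaf {v} v∈leafSet = does≡true⇒ (degree G v ≟ 1) (∈-tabulate⁻ v∈leafSet)

  Adj-sym : Adj u v → Adj v u
  Adj-sym {u} {v} uv = trans (Graph.sym G v u) uv

  Adj⇒≢ : Adj u v → u ≢ v
  Adj⇒≢ {u} uu refl with trans (sym uu) (Graph.irrefl G u)
  ... | ()

  leaf-neighbour-unique : Leaf v → Adj v x → Adj v y → x ≡ y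
  leaf-neighbour-unique leaf vx vy = ∣p∣≤1⇒∈-unique (≤-reflexive leaf) (∈-tabulate⁺ vx) (∈-tabulate⁺ vy)

  other-endpoint : ∀ e → endpoint G x e → Σ (Fin n) λ y → endpoint G y e × Adj x y
  other-endpoint (a , b , _ , ab) (inj₁ refl) = b , inj₂ refl , ab
  other-endpoint (a , b , _ , ab) (inj₂ refl) = a , inj₁ refl , Adj-sym ab

  endpoints-Adj : ∀ e → x ≢ y → endpoint G x e → endpoint G y e → Adj x y
  endpoints-Adj (a , b , _ , ab) x≢y xe ye with distinct-pair-cases x≢y xe ye
  ... | inj₁ (refl , refl) = ab
  ... | inj₂ (refl , refl) = Adj-sym ab

  endpoint-cases : ∀ e → x ≢ y → endpoint G x e → endpoint G y e → endpoint G z e → z ≡ x ⊎ z ≡ y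
  endpoint-cases (a , b , _) x≢y xe ye ze with distinct-pair-cases x≢y xe ye
  ... | inj₁ (refl , refl) = ze
  ... | inj₂ (refl , refl) = swap ze

  Edge-irrelevant : ∀ {a b} (a<b a<b′ : toℕ a < toℕ b) (ab ab′ : Adj a b) →
                    _≡_ {A = Edge G} (a , b , a<b , ab) (a , b , a<b′ , ab′)
  Edge-irrelevant a<b a<b′ ab ab′ =
    cong₂ (λ p q → (_ , _ , p , q)) (<-irrelevant a<b a<b′) (Decidable⇒UIP.≡-irrelevant Bool._≟_ ab ab′)

  endpoints-determine-edge : ∀ e f → x ≢ y → endpoint G x e → endpoint G y e →
                             endpoint G x f → endpoint G y f → e ≡ f
  endpoints-determine-edge (a , b , a<b , ab) (c , d , c<d , cd) x≢y xe ye xf yf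
    with distinct-pair-cases x≢y xe ye | distinct-pair-cases x≢y xf yf
  ... | inj₁ (refl , refl) | inj₁ (refl , refl) = Edge-irrelevant a<b c<d ab cd
  ... | inj₂ (refl , refl) | inj₂ (refl , refl) = Edge-irrelevant a<b c<d ab cd
  ... | inj₁ (refl , refl) | inj₂ (refl , refl) = contradiction c<d (<-asym a<b)
  ... | inj₂ (refl , refl) | inj₁ (refl , refl) = contradiction c<d (<-asym a<b)

  isolated-edge-has-no-edge-neighbour : Leaf u → Leaf v → Adj u v → endpoint G u e → endpoint G v e →
                                        ¬ MAdj G (inj₂ e) (inj₂ f)
  isolated-edge-has-no-edge-neighbour {u} {v} {e} {f} lu lv uv ue ve (e≢f , y , ye , yf) =
    e≢f (endpoints-determine-edge e f (Adj⇒≢ uv) ue ve (proj₁ uf×vf) (proj₂ uf×vf))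
    where
    uf×vf : endpoint G u f × endpoint G v f
    uf×vf with endpoint-cases e (Adj⇒≢ uv) ue ve ye | other-endpoint f yf
    ... | inj₁ refl | z , zf , uz = yf , subst (λ k → endpoint G k f) (leaf-neighbour-unique lu uz uv) zf
    ... | inj₂ refl | z , zf , vz = subst (λ k → endpoint G k f) (leaf-neighbour-unique lv vz (Adj-sym uv)) zf , yf

  data Charge (v : Fin n) : MVertex G → Set where
    edge   : endpoint G v e → (∀ {w} → Adj v w → Leaf w → toℕ v ≤ toℕ w) → Charge v (inj₂ e)
    vertex : Adj v u → Leaf u → toℕ u < toℕ v → x ≡ v ⊎ x ≡ u → Charge v (inj₁ x)

  Charge-injective : Leaf v → Leaf w → Charge v c → Charge w c → v ≡ w
  Charge-injective {v} {w} lv lw (edge {e} ve v-min) (edge we w-min) with v Fin.≟ w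
  ... | yes v≡w = v≡w
  ... | no v≢w  = contradiction (toℕ-injective (≤-antisym (v-min vw lw) (w-min (Adj-sym vw) lv))) v≢w
    where vw = endpoints-Adj e v≢w ve we
  Charge-injective lv lw (vertex _ _ _ (inj₁ refl)) (vertex _ _ _ (inj₁ refl)) = refl
  Charge-injective lv lw (vertex vu _ u<v (inj₁ refl)) (vertex wv _ v<w (inj₂ refl))
    with refl ← leaf-neighbour-unique lv vu (Adj-sym wv) = contradiction v<w (<-asym u<v)
  Charge-injective lv lw (vertex vw _ w<v (inj₂ refl)) (vertex wu _ u<w (inj₁ refl))
    with refl ← leaf-neighbour-unique lw wu (Adj-sym vw) = contradiction w<v (<-asym u<w)
  Charge-injective lv lw (vertex vu lu _ (inj₂ refl)) (vertex wu _ _ (inj₂ refl)) =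
    leaf-neighbour-unique lu (Adj-sym vu) (Adj-sym wu)

  module _ {S : List (MVertex G)} (S-tds : IsTDSMiddle G S) where

    charge : Leaf v → Σ (MVertex G) λ c → c ∈ₗ S × Charge v c
    charge {v} lv with find (S-tds (inj₁ v))
    ... | inj₂ e , e∈S , ve with other-endpoint e ve
    ... | u , ue , vu with (degree G u ≟ 1) ×-dec (toℕ u <? toℕ v)
    ... | no ¬lu×u<v = inj₂ e , e∈S , edge ve v-min
      where
      v-min : ∀ {w} → Adj v w → Leaf w → toℕ v ≤ toℕ w
      v-min vw lw with refl ← leaf-neighbour-unique lv vw vu = ≮⇒≥ (λ w<v → ¬lu×u<v (lw , w<v))
    ... | yes (lu , u<v) with find (S-tds (inj₂ e))
    ... | inj₁ x , x∈S , xe = inj₁ x , x∈S , vertex vu lu u<v (endpoint-cases e (Adj⇒≢ vu) ve ue xe)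
    ... | inj₂ f , _ , ef = contradiction ef (isolated-edge-has-no-edge-neighbour lv lu vu ve ue)

    numLeaves≤length : numLeaves G ≤ length S
    numLeaves≤length = injection⇒∣p∣≤m position position-injective
      where
      charge-of : v ∈ leafSet G → Σ (MVertex G) λ c → c ∈ₗ S × Charge v c
      charge-of = charge ∘ ∈-leafSet⇒Leaf
      position : v ∈ leafSet G → Fin (length S)
      position = index ∘ proj₁ ∘ proj₂ ∘ charge-of
      position-injective : (v∈ : v ∈ leafSet G) (w∈ : w ∈ leafSet G) → position v∈ ≡ position w∈ → v ≡ w
      position-injective {v} {w} v∈ w∈ eq with charge-of v∈ | charge-of w∈
      ... | c , c∈S , v↦c | d , d∈S , w↦d with refl ← index-injective (setoid _) c∈S d∈S eq =
        Charge-injective (∈-leafSet⇒Leaf v∈) (∈-leafSet⇒Leaf w∈) v↦c w↦d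

proposition3p1 : (n : ℕ) → 2 ≤ n → (T : Graph n) → IsTree T →
                 γt-Middle-≥ T (numLeaves T)
proposition3p1 n _ T _ S _ S-tds = numLeaves≤length T S-tds
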